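{- For every $\delta>0$ there exists $\gamma>0$ such that if $G$ is a graph on $n$ vertices with at least $\left(\frac15-\gamma\right)n^2$ edges and at least $\delta n$ vertices of degree at least $\left(\frac25+\delta\right)n$, then $\frac1n\sum_{v\in V(G)}d(v)^2\ge\left(\frac25 n\right)^2$.
   Context: $d(v)$ denotes the degree of $v$ in $G$.
   Formalization: The parameter δ ranges over the positive rationals, and the parameter γ is taken in the rationals. -}

module Defs where

open import Data.Nat using (ℕ; zero; suc; _+_; _*_)
open import Data.Bool using (Bool; true; false; if_then_else_)
open import Data.Fin using (Fin; _<_)
open import Data.Fin.Properties using (_<?_)
open import Data.Integer using (+_)
open import Data.Rational using (ℚ; _/_)
open import Relation.Binary.PropositionalEquality using (_≡_)
open import Relation.Nullary using (¬_; does)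

sumFin : (n : ℕ) → (Fin n → ℕ) → ℕ
sumFin zero f = 0
sumFin (suc n) f = f Fin.zero + sumFin n (λ i → f (Fin.suc i))
  where import Data.Fin as Fin

countFin : (n : ℕ) → (Fin n → Bool) → ℕ
countFin n p = sumFin n (λ i → if p i then 1 else 0)

record Graph (n : ℕ) : Set where
  field
    adj   : Fin n → Fin n → Bool
    sym   : ∀ u v → adj u v ≡ adj v u
    irref : ∀ v → adj v v ≡ false
open Graph public

deg : ∀ {n} → Graph n → Fin n → ℕ
deg {n} G v = countFin n (adj G v)

edges : ∀ {n} → Graph n → ℕ
edges {n} G = sumFin n (λ u → countFin n (λ v → if does (u <? v) then adj G u v else false))

ℕ→ℚ : ℕ → ℚ
ℕ→ℚ n = + n / 1

module Submission where

-- Proof idea (a tangent-line bound for the second moment of the degrees).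
-- Put t = 2n/5 and s = δn.  For every rational x we have x² + t² ≥ 2tx,
-- since the difference is (x − t)², and if moreover x ≥ t + s with s ≥ 0
-- then x² + t² ≥ 2tx + s².  Summing over the degrees and using the
-- handshake lemma Σ d(v) = 2e(G) gives
--   Σ d(v)² + n t² ≥ 4t · e(G) + s² · #{v : d(v) ≥ t + s}
--                  ≥ 4t (1/5 − γ) n² + δ³n³ = 2n t² + (δ³ − 8γ/5) n³,
-- and with γ = δ³/2 the last term is δ³n³/5 ≥ 0, so Σ d(v)² ≥ n t².

open import Defs hiding (sym)
open import Algebra.Bundles using (CommutativeRing)
open import Data.Bool using (Bool; false; if_then_else_)
open import Data.Fin using (Fin; zero; suc)
open import Data.Fin.Properties using (_<?_; <-asym; <-cmp)
open import Data.Empty using (⊥-elim)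
open import Data.Integer as ℤ using (+_)
import Data.Integer.Properties as ℤP
open import Data.Nat as ℕ using (ℕ)
import Data.Nat.Coprimality as Coprimality
import Data.Nat.Properties as ℕP
open import Data.Product using (Σ; _×_; _,_)
open import Data.Sum using (inj₁; inj₂)
open import Data.Rational
  using (ℚ; mkℚ; 0ℚ; 1ℚ; _+_; _*_; _-_; -_; _≤_; _<_; _/_; Positive; positive; nonNegative; nonPositive)
import Data.Rational.Properties as ℚP
open import Data.Rational.Properties using (_≤?_)
open import Data.Rational.Solver using (module +-*-Solver)
import Data.Rational.Unnormalised as ℚᵘ
import Data.Rational.Unnormalised.Properties as ℚᵘP
open import Relation.Binary using (tri<; tri≈; tri>)
open import Relation.Binary.PropositionalEquality
open import Relation.Nullary using (Dec; yes; no; does)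

import Algebra.Properties.CommutativeMonoid.Sum as MonoidSum
import Algebra.Properties.Semiring.Sum as SemiringSum

module ℕΣ = MonoidSum ℕP.+-0-commutativeMonoid
module ℚΣ = SemiringSum (CommutativeRing.semiring ℚP.+-*-commutativeRing)

sumFin≡sum : ∀ n (f : Fin n → ℕ) → sumFin n f ≡ ℕΣ.sum f
sumFin≡sum ℕ.zero    f = refl
sumFin≡sum (ℕ.suc n) f = cong (f zero ℕ.+_) (sumFin≡sum n (λ i → f (suc i)))

𝟙 : Bool → ℕ
𝟙 b = if b then 1 else 0

forward : ∀ {n} → Graph n → Fin n → Fin n → ℕ
forward G u v = 𝟙 (if does (u <? v) then adj G u v else false)

-- Each adjacent pair is counted exactly once by forward u v or forward v u:
-- by symmetry if v < u, and never when u = v by irreflexivity.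
adj-split : ∀ {n} (G : Graph n) u v → 𝟙 (adj G u v) ≡ forward G u v ℕ.+ forward G v u
adj-split G u v = split (u <? v) (v <? u)
  where
  split : (u<v : Dec (u Data.Fin.< v)) (v<u : Dec (v Data.Fin.< u)) →
    𝟙 (adj G u v) ≡ 𝟙 (if does u<v then adj G u v else false)
                    ℕ.+ 𝟙 (if does v<u then adj G v u else false)
  split (yes p) (yes q) = ⊥-elim (<-asym p q)
  split (yes _) (no _)  = sym (ℕP.+-identityʳ _)
  split (no _)  (yes _) = cong 𝟙 (Graph.sym G u v)
  split (no p)  (no q) with <-cmp u v
  ... | tri< u<v _ _ = ⊥-elim (p u<v)
  ... | tri> _ _ v<u = ⊥-elim (q v<u)
  ... | tri≈ _ refl _ = cong 𝟙 (irref G u)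

handshake : ∀ {n} (G : Graph n) → sumFin n (deg G) ≡ edges G ℕ.+ edges G
handshake {n} G = begin
  sumFin n (deg G)
    ≡⟨ sumFin≡sum n (deg G) ⟩
  ℕΣ.sum {n} (λ u → sumFin n (λ v → 𝟙 (adj G u v)))
    ≡⟨ ℕΣ.sum-cong-≗ {n} (λ u → sumFin≡sum n _) ⟩
  ℕΣ.sum {n} (λ u → ℕΣ.sum {n} (λ v → 𝟙 (adj G u v)))
    ≡⟨ ℕΣ.sum-cong-≗ {n} (λ u → ℕΣ.sum-cong-≗ (adj-split G u)) ⟩
  ℕΣ.sum {n} (λ u → ℕΣ.sum {n} (λ v → forward G u v ℕ.+ forward G v u))
    ≡⟨ ℕΣ.sum-cong-≗ {n} (λ u → ℕΣ.∑-distrib-+ (forward G u) (λ v → forward G v u)) ⟩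
  ℕΣ.sum {n} (λ u → ℕΣ.sum (forward G u) ℕ.+ ℕΣ.sum {n} (λ v → forward G v u))
    ≡⟨ ℕΣ.∑-distrib-+ {n} _ _ ⟩
  F ℕ.+ ℕΣ.sum {n} (λ u → ℕΣ.sum {n} (λ v → forward G v u))
    ≡⟨ cong (F ℕ.+_) (sym (ℕΣ.∑-comm (forward G))) ⟩
  F ℕ.+ F
    ≡⟨ cong₂ ℕ._+_ edges≡F edges≡F ⟨
  edges G ℕ.+ edges G ∎
  where
  open ≡-Reasoning
  F = ℕΣ.sum {n} (λ u → ℕΣ.sum (forward G u))
  edges≡F : edges G ≡ F
  edges≡F = trans (sumFin≡sum n _) (ℕΣ.sum-cong-≗ {n} (λ u → sumFin≡sum n (forward G u)))

-- The embedding ℕ → ℚ is the rational n/1 already in lowest terms, so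
-- its arithmetic can be checked on the unnormalised rationals, where + and
-- * are evaluated without any gcd normalisation.
n/1 : ℕ → ℚ
n/1 n = mkℚ (+ n) 0 (Coprimality.sym (Coprimality.1-coprimeTo n))

ℕ→ℚ≡n/1 : ∀ n → ℕ→ℚ n ≡ n/1 n
ℕ→ℚ≡n/1 n = ℚP.normalize-coprime _

ℕ→ℚ-+ : ∀ a b → ℕ→ℚ (a ℕ.+ b) ≡ ℕ→ℚ a + ℕ→ℚ b
ℕ→ℚ-+ a b rewrite ℕ→ℚ≡n/1 (a ℕ.+ b) | ℕ→ℚ≡n/1 a | ℕ→ℚ≡n/1 b =
  ℚP.toℚᵘ-injective (ℚᵘP.≃-trans (ℚᵘ.*≡* integral) (ℚᵘP.≃-sym (ℚP.toℚᵘ-homo-+ (n/1 a) (n/1 b))))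
  where
  integral : + (a ℕ.+ b) ℤ.* + 1 ≡ (+ a ℤ.* + 1 ℤ.+ + b ℤ.* + 1) ℤ.* + 1
  integral rewrite ℤP.*-identityʳ (+ a) | ℤP.*-identityʳ (+ b)
                 | ℤP.*-identityʳ (+ a ℤ.+ + b) = ℤP.pos-+ a b

ℕ→ℚ-* : ∀ a b → ℕ→ℚ (a ℕ.* b) ≡ ℕ→ℚ a * ℕ→ℚ b
ℕ→ℚ-* a b rewrite ℕ→ℚ≡n/1 (a ℕ.* b) | ℕ→ℚ≡n/1 a | ℕ→ℚ≡n/1 b =
  ℚP.toℚᵘ-injective (ℚᵘP.≃-trans (ℚᵘ.*≡* integral) (ℚᵘP.≃-sym (ℚP.toℚᵘ-homo-* (n/1 a) (n/1 b))))
  where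
  integral : + (a ℕ.* b) ℤ.* + 1 ≡ (+ a ℤ.* + b) ℤ.* + 1
  integral rewrite ℤP.*-identityʳ (+ a ℤ.* + b) | ℤP.*-identityʳ (+ (a ℕ.* b)) = ℤP.pos-* a b

ℕ→ℚ-nonNeg : ∀ a → 0ℚ ≤ ℕ→ℚ a
ℕ→ℚ-nonNeg a rewrite ℕ→ℚ≡n/1 a = ℚP.nonNegative⁻¹ (n/1 a)

ℕ→ℚ-sum : ∀ n (f : Fin n → ℕ) → ℕ→ℚ (sumFin n f) ≡ ℚΣ.sum (λ i → ℕ→ℚ (f i))
ℕ→ℚ-sum ℕ.zero    f = refl
ℕ→ℚ-sum (ℕ.suc n) f =
  trans (ℕ→ℚ-+ (f zero) _) (cong (λ rest → ℕ→ℚ (f zero) + rest) (ℕ→ℚ-sum n (λ i → f (suc i))))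

ℚ-sum-const : ∀ n c → ℚΣ.sum {n} (λ _ → c) ≡ ℕ→ℚ n * c
ℚ-sum-const ℕ.zero    c = sym (ℚP.*-zeroˡ c)
ℚ-sum-const (ℕ.suc n) c = begin
  c + ℚΣ.sum {n} (λ _ → c)   ≡⟨ cong (λ rest → c + rest) (ℚ-sum-const n c) ⟩
  c + ℕ→ℚ n * c             ≡⟨ cong (_+ ℕ→ℚ n * c) (ℚP.*-identityˡ c) ⟨
  1ℚ * c + ℕ→ℚ n * c        ≡⟨ ℚP.*-distribʳ-+ c 1ℚ (ℕ→ℚ n) ⟨
  (1ℚ + ℕ→ℚ n) * c          ≡⟨ cong (_* c) (ℕ→ℚ-+ 1 n) ⟨
  ℕ→ℚ (ℕ.suc n) * c ∎
  where open ≡-Reasoning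

ℚ-sum-mono : ∀ n {f g : Fin n → ℚ} → (∀ i → f i ≤ g i) → ℚΣ.sum f ≤ ℚΣ.sum g
ℚ-sum-mono ℕ.zero    f≤g = ℚP.≤-refl
ℚ-sum-mono (ℕ.suc n) f≤g = ℚP.+-mono-≤ (f≤g zero) (ℚ-sum-mono n (λ i → f≤g (suc i)))

nonNeg-* : ∀ {a b} → 0ℚ ≤ a → 0ℚ ≤ b → 0ℚ ≤ a * b
nonNeg-* {a} {b} 0≤a 0≤b = ℚP.nonNegative⁻¹ (a * b)
  {{ℚP.nonNeg*nonNeg⇒nonNeg a {{nonNegative 0≤a}} b {{nonNegative 0≤b}}}}

square-nonNeg : ∀ y → 0ℚ ≤ y * y
square-nonNeg y with ℚP.≤-total 0ℚ y
... | inj₁ 0≤y = nonNeg-* 0≤y 0≤y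
... | inj₂ y≤0 = ℚP.nonNegative⁻¹ (y * y)
  {{ℚP.nonPos*nonPos⇒nonPos y {{nonPositive y≤0}} y {{nonPositive y≤0}}}}

square-mono : ∀ {a b} → 0ℚ ≤ a → a ≤ b → a * a ≤ b * b
square-mono {a} {b} 0≤a a≤b = ℚP.≤-trans
  (ℚP.*-monoˡ-≤-nonNeg a {{nonNegative 0≤a}} a≤b)
  (ℚP.*-monoʳ-≤-nonNeg b {{nonNegative (ℚP.≤-trans 0≤a a≤b)}} a≤b)

≤-+-nonNeg : ∀ a {b} → 0ℚ ≤ b → a ≤ a + b
≤-+-nonNeg a {b} 0≤b = subst (_≤ a + b) (ℚP.+-identityʳ a) (ℚP.+-monoʳ-≤ a 0≤b)

+-cancelʳ-≤ : ∀ a b c → a + c ≤ b + c → a ≤ b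
+-cancelʳ-≤ a b c a+c≤b+c = begin
  a           ≡⟨ cancel a ⟨
  a + c - c   ≤⟨ ℚP.+-monoˡ-≤ (- c) a+c≤b+c ⟩
  b + c - c   ≡⟨ cancel b ⟩
  b ∎
  where
  open ℚP.≤-Reasoning
  cancel : ∀ x → x + c - c ≡ x
  cancel x = trans (ℚP.+-assoc x c (- c))
               (trans (cong (λ y → x + y) (ℚP.+-inverseʳ c)) (ℚP.+-identityʳ x))

-- x² + t² = 2tx + (x − t)²: the square lies above each of its tangent lines.
square-expansion : ∀ t x → x * x + t * t ≡ (t + t) * x + (x - t) * (x - t)
square-expansion = solve 2 (λ t x → x :* x :+ t :* t := (t :+ t) :* x :+ (x :- t) :* (x :- t)) refl
  where open +-*-Solver

tangent-line : ∀ t x → (t + t) * x ≤ x * x + t * t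
tangent-line t x = subst ((t + t) * x ≤_) (sym (square-expansion t x))
  (≤-+-nonNeg ((t + t) * x) (square-nonNeg (x - t)))

tangent-line-gap : ∀ t s x → 0ℚ ≤ s → t + s ≤ x → (t + t) * x + s * s ≤ x * x + t * t
tangent-line-gap t s x 0≤s t+s≤x = subst ((t + t) * x + s * s ≤_) (sym (square-expansion t x))
  (ℚP.+-monoʳ-≤ ((t + t) * x) (square-mono 0≤s s≤x-t))
  where
  s≤x-t : s ≤ x - t
  s≤x-t = begin
    s           ≡⟨ solve 2 (λ s t → s := t :+ s :- t) refl s t ⟩
    t + s - t   ≤⟨ ℚP.+-monoˡ-≤ (- t) t+s≤x ⟩
    x - t ∎
    where
    open ℚP.≤-Reasoning
    open +-*-Solver

tangent-line-indicator : ∀ t s θ x → 0ℚ ≤ s → t + s ≤ θ → (θ≤x : Dec (θ ≤ x)) →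
  (t + t) * x + s * s * ℕ→ℚ (𝟙 (does θ≤x)) ≤ x * x + t * t
tangent-line-indicator t s θ x 0≤s t+s≤θ (yes θ≤x) =
  subst (λ gap → (t + t) * x + gap ≤ x * x + t * t) (sym (ℚP.*-identityʳ (s * s)))
    (tangent-line-gap t s x 0≤s (ℚP.≤-trans t+s≤θ θ≤x))
tangent-line-indicator t s θ x 0≤s t+s≤θ (no _) =
  subst (_≤ x * x + t * t) dropGap (tangent-line t x)
  where
  dropGap : (t + t) * x ≡ (t + t) * x + s * s * 0ℚ
  dropGap = solve 3 (λ t s x → (t :+ t) :* x := (t :+ t) :* x :+ s :* s :* con 0ℚ) refl t s x
    where open +-*-Solver

second-moment-bound : ∀ n (x : Fin n → ℚ) t s θ → 0ℚ ≤ s → t + s ≤ θ →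
  (t + t) * ℚΣ.sum x + s * s * ℕ→ℚ (countFin n (λ v → does (θ ≤? x v)))
    ≤ ℚΣ.sum (λ v → x v * x v) + ℕ→ℚ n * (t * t)
second-moment-bound n x t s θ 0≤s t+s≤θ = begin
  (t + t) * ℚΣ.sum x + s * s * ℕ→ℚ (countFin n high)
    ≡⟨ cong (λ c → (t + t) * ℚΣ.sum x + s * s * c) (ℕ→ℚ-sum n (λ v → 𝟙 (high v))) ⟩
  (t + t) * ℚΣ.sum x + s * s * ℚΣ.sum χ
    ≡⟨ cong₂ _+_ (ℚΣ.*-distribˡ-sum (t + t) x) (ℚΣ.*-distribˡ-sum (s * s) χ) ⟩
  ℚΣ.sum (λ v → (t + t) * x v) + ℚΣ.sum (λ v → s * s * χ v)
    ≡⟨ ℚΣ.∑-distrib-+ (λ v → (t + t) * x v) (λ v → s * s * χ v) ⟨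
  ℚΣ.sum (λ v → (t + t) * x v + s * s * χ v)
    ≤⟨ ℚ-sum-mono n (λ v → tangent-line-indicator t s θ (x v) 0≤s t+s≤θ (θ ≤? x v)) ⟩
  ℚΣ.sum (λ v → x v * x v + t * t)
    ≡⟨ ℚΣ.∑-distrib-+ (λ v → x v * x v) (λ _ → t * t) ⟩
  ℚΣ.sum (λ v → x v * x v) + ℚΣ.sum {n} (λ _ → t * t)
    ≡⟨ cong (λ c → ℚΣ.sum (λ v → x v * x v) + c) (ℚ-sum-const n (t * t)) ⟩
  ℚΣ.sum (λ v → x v * x v) + ℕ→ℚ n * (t * t) ∎
  where
  open ℚP.≤-Reasoning
  high : Fin n → Bool
  high v = does (θ ≤? x v)
  χ : Fin n → ℚ
  χ v = ℕ→ℚ (𝟙 (high v))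

degree-second-moment : ∀ {n} (G : Graph n) t s θ → 0ℚ ≤ s → t + s ≤ θ →
  (t + t) * (ℕ→ℚ (edges G) + ℕ→ℚ (edges G))
    + s * s * ℕ→ℚ (countFin n (λ v → does (θ ≤? ℕ→ℚ (deg G v))))
    ≤ ℕ→ℚ (sumFin n (λ v → deg G v ℕ.* deg G v)) + ℕ→ℚ n * (t * t)
degree-second-moment {n} G t s θ 0≤s t+s≤θ =
  subst₂ (λ D S → (t + t) * D + s * s * C ≤ S + ℕ→ℚ n * (t * t))
    degreeSum squareSum (second-moment-bound n d t s θ 0≤s t+s≤θ)
  where
  d : Fin n → ℚ
  d v = ℕ→ℚ (deg G v)
  C = ℕ→ℚ (countFin n (λ v → does (θ ≤? d v)))
  degreeSum : ℚΣ.sum d ≡ ℕ→ℚ (edges G) + ℕ→ℚ (edges G)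
  degreeSum = trans (sym (ℕ→ℚ-sum n (deg G)))
                (trans (cong ℕ→ℚ (handshake G)) (ℕ→ℚ-+ (edges G) (edges G)))
  squareSum : ℚΣ.sum (λ v → d v * d v) ≡ ℕ→ℚ (sumFin n (λ v → deg G v ℕ.* deg G v))
  squareSum = sym (trans (ℕ→ℚ-sum n _) (ℚΣ.sum-cong-≗ {n} (λ v → ℕ→ℚ-* (deg G v) (deg G v))))

edgeDeficit : ℚ → ℚ
edgeDeficit δ = δ * δ * δ * (+ 1 / 2)

edgeDeficit-pos : ∀ δ → 0ℚ < δ → 0ℚ < edgeDeficit δ
edgeDeficit-pos δ 0<δ = ℚP.positive⁻¹ (edgeDeficit δ)
  {{ℚP.pos*pos⇒pos (δ * δ * δ) {{ℚP.pos*pos⇒pos (δ * δ) {{ℚP.pos*pos⇒pos δ δ}} δ}} (+ 1 / 2)}}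
  where
  instance
    δ-pos : Positive δ
    δ-pos = positive 0<δ

-- Closing arithmetic with t = 2N/5: if E ≥ (1/5 − γ)N² and C ≥ δN, then
-- 2t·2E + (δN)²C ≥ (8/25 − 4δ³/5)N³ + δ³N³ = 2N t² + δ³N³/5 ≥ 2N t².
closing-arithmetic : ∀ δ N E C → 0ℚ ≤ δ → 0ℚ ≤ N →
  ((+ 1 / 5) - edgeDeficit δ) * (N * N) ≤ E → δ * N ≤ C →
  let t = (+ 2 / 5) * N in
  N * (t * t) + N * (t * t) ≤ (t + t) * (E + E) + (δ * N) * (δ * N) * C
closing-arithmetic δ N E C 0≤δ 0≤N A≤E δN≤C = begin
  N * (t * t) + N * (t * t)
    ≤⟨ ≤-+-nonNeg _ surplus-nonNeg ⟩
  N * (t * t) + N * (t * t) + (+ 1 / 5) * δN * δN * δN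
    ≡⟨ solve 2 (λ δ N →
         let t = con (+ 2 / 5) :* N
             A = (con (+ 1 / 5) :- δ :* δ :* δ :* con (+ 1 / 2)) :* (N :* N)
         in N :* (t :* t) :+ N :* (t :* t) :+ con (+ 1 / 5) :* (δ :* N) :* (δ :* N) :* (δ :* N)
            := (t :+ t) :* (A :+ A) :+ (δ :* N) :* (δ :* N) :* (δ :* N)) refl δ N ⟩
  (t + t) * (A + A) + δN * δN * δN
    ≤⟨ ℚP.+-mono-≤ (ℚP.*-monoˡ-≤-nonNeg (t + t) {{nonNegative 2t-nonNeg}}
                     (ℚP.+-mono-≤ A≤E A≤E))
                   (ℚP.*-monoˡ-≤-nonNeg (δN * δN) {{nonNegative (square-nonNeg δN)}} δN≤C) ⟩
  (t + t) * (E + E) + δN * δN * C ∎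
  where
  open ℚP.≤-Reasoning
  open +-*-Solver
  t = (+ 2 / 5) * N
  δN = δ * N
  A = ((+ 1 / 5) - edgeDeficit δ) * (N * N)
  δN-nonNeg : 0ℚ ≤ δN
  δN-nonNeg = nonNeg-* 0≤δ 0≤N
  surplus-nonNeg : 0ℚ ≤ (+ 1 / 5) * δN * δN * δN
  surplus-nonNeg = nonNeg-* (nonNeg-* (nonNeg-* (ℚP.nonNegative⁻¹ (+ 1 / 5)) δN-nonNeg) δN-nonNeg) δN-nonNeg
  2t-nonNeg : 0ℚ ≤ t + t
  2t-nonNeg = ℚP.+-mono-≤ t-nonNeg t-nonNeg
    where
    t-nonNeg : 0ℚ ≤ t
    t-nonNeg = nonNeg-* (ℚP.nonNegative⁻¹ (+ 2 / 5)) 0≤N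

degree-square-sum-bound : ∀ δ → 0ℚ ≤ δ → (n : ℕ) (G : Graph n) →
  ((+ 1 / 5) - edgeDeficit δ) * ℕ→ℚ (n ℕ.* n) ≤ ℕ→ℚ (edges G) →
  δ * ℕ→ℚ n ≤ ℕ→ℚ (countFin n (λ v → does (((+ 2 / 5) + δ) * ℕ→ℚ n ≤? ℕ→ℚ (deg G v)))) →
  ℕ→ℚ n * (((+ 2 / 5) * ℕ→ℚ n) * ((+ 2 / 5) * ℕ→ℚ n))
    ≤ ℕ→ℚ (sumFin n (λ v → deg G v ℕ.* deg G v))
degree-square-sum-bound δ 0≤δ n G manyEdges manyHigh =
  +-cancelʳ-≤ (N * (t * t)) _ (N * (t * t))
    (ℚP.≤-trans (closing-arithmetic δ N (ℕ→ℚ (edges G)) _ 0≤δ 0≤N manyEdges′ manyHigh)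
                (degree-second-moment G t (δ * N) θ (nonNeg-* 0≤δ 0≤N) (ℚP.≤-reflexive t+δN≡θ)))
  where
  N = ℕ→ℚ n
  t = (+ 2 / 5) * N
  θ = ((+ 2 / 5) + δ) * N
  0≤N : 0ℚ ≤ N
  0≤N = ℕ→ℚ-nonNeg n
  manyEdges′ : ((+ 1 / 5) - edgeDeficit δ) * (N * N) ≤ ℕ→ℚ (edges G)
  manyEdges′ = subst (λ M → ((+ 1 / 5) - edgeDeficit δ) * M ≤ ℕ→ℚ (edges G)) (ℕ→ℚ-* n n) manyEdges
  t+δN≡θ : t + δ * N ≡ θ
  t+δN≡θ = sym (ℚP.*-distribʳ-+ N (+ 2 / 5) δ)

lemma5p6 : (δ : ℚ) → 0ℚ < δ →
    Σ ℚ (λ γ → 0ℚ < γ ×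
      ((n : ℕ) (G : Graph n) →
        ((+ 1 / 5) - γ) Data.Rational.* ℕ→ℚ (n ℕ.* n) ≤ ℕ→ℚ (edges G) →
        δ Data.Rational.* ℕ→ℚ n ≤ ℕ→ℚ (countFin n (λ v → does (((+ 2 / 5) + δ) Data.Rational.* ℕ→ℚ n ≤? ℕ→ℚ (deg G v)))) →
        ℕ→ℚ n Data.Rational.* (((+ 2 / 5) Data.Rational.* ℕ→ℚ n) Data.Rational.* ((+ 2 / 5) Data.Rational.* ℕ→ℚ n))
          ≤ ℕ→ℚ (sumFin n (λ v → deg G v ℕ.* deg G v))))
lemma5p6 δ 0<δ =
  edgeDeficit δ , edgeDeficit-pos δ 0<δ , degree-square-sum-bound δ (ℚP.<⇒≤ 0<δ)
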